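{- Every finite simple graph is an induced subgraph of some finite simple graph $\Lambda$ satisfying $\Lambda_2\cong\Lambda$.
   Context: For a finite simple graph $\Lambda$ with path-distance $d$, the $2$-distance graph $\Lambda_2$ is the graph with vertex set $V(\Lambda)$ in which two distinct vertices $u,v$ are adjacent if and only if $d(u,v)=2$. A graph $\Lambda$ with $\Lambda_2\cong\Lambda$ is called a self $2$-distance graph. -}

module Defs where

open import Data.Nat using (ℕ; zero; suc; _<_)
open import Data.Fin using (Fin)
open import Data.Bool using (Bool; true; false)
open import Data.Product using (Σ; _×_; ∃-syntax)
open import Relation.Binary.PropositionalEquality using (_≡_)
open import Relation.Nullary using (¬_)
open import Function.Bundles using (_⤖_; _⇔_; Bijection)
open import Function.Definitions using (Injective)

record SimpleGraph : Set where
  field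
    n     : ℕ
    adj   : Fin n → Fin n → Bool
    sym   : ∀ u v → adj u v ≡ adj v u
    loopless : ∀ v → adj v v ≡ false

open SimpleGraph public

Adj : (G : SimpleGraph) → Fin (n G) → Fin (n G) → Set
Adj G u v = adj G u v ≡ true

data Walk (G : SimpleGraph) : ℕ → Fin (n G) → Fin (n G) → Set where
  here : ∀ {u} → Walk G zero u u
  step : ∀ {k u w v} → Adj G u w → Walk G k w v → Walk G (suc k) u v

Dist : (G : SimpleGraph) → Fin (n G) → Fin (n G) → ℕ → Set
Dist G u v k = Walk G k u v × (∀ m → m < k → ¬ Walk G m u v)

Adj₂ : (G : SimpleGraph) → Fin (n G) → Fin (n G) → Set
Adj₂ G u v = Dist G u v 2

SelfTwoDistance : SimpleGraph → Set
SelfTwoDistance Λ =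
  Σ (Fin (n Λ) ⤖ Fin (n Λ)) λ f →
    ∀ u v → (Adj₂ Λ u v ⇔ Adj Λ (Bijection.to f u) (Bijection.to f v))

InducedSubgraph : SimpleGraph → SimpleGraph → Set
InducedSubgraph G Λ =
  Σ (Fin (n G) → Fin (n Λ)) λ g →
    Injective _≡_ _≡_ g × (∀ a b → adj G a b ≡ adj Λ (g a) (g b))

-- If every two distinct non-adjacent vertices of Λ have a common
-- neighbour ("diameter at most two"), then d(u,v) = 2 exactly when u ≠ v and
-- u, v are non-adjacent, i.e. Λ₂ is the complement of Λ.  So it suffices to
-- embed G into a self-complementary graph of diameter at most two.
--
-- Blow up the pentagon  centre – P1 – P2 – P3 – P4 – centre :
-- keep the centre a single vertex, replace P1 and P4 by copies of G and P2,
-- P3 by copies of the complement of G, and join consecutive blobs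
-- completely.  Reading the pentagon as ℤ/5 (centre = 0, Pi = i), doubling
-- maps its edges (difference ±1) onto its non-edges (difference ±2) and
-- swaps the copies of G with the copies of its complement, so it is an
-- isomorphism from the complement onto the blow-up.
module Submission where

open import Defs hiding (sym)
open import Data.Bool using (Bool; true; false; not; _∧_)
open import Data.Bool.Properties using (∧-identityʳ; ∧-zeroʳ; not-involutive; ¬-not)
open import Data.Fin using (Fin; zero; suc; _≟_)
open import Data.Fin.Properties using (+↔⊎; *↔×; 1↔⊤)
open import Data.Nat using (ℕ; suc; _*_; _<_; s≤s; z≤n)
open import Data.Product using (Σ; _×_; _,_; ∃-syntax)
open import Data.Product.Function.NonDependent.Propositional using (_×-↔_)
open import Data.Sum using (_⊎_; inj₁; inj₂)
open import Data.Sum.Function.Propositional using (_⊎-↔_)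
open import Data.Unit using (⊤; tt)
open import Function using (_∘_)
open import Function.Bundles using (_↔_; _⤖_; _⇔_; mk⇔; mk↔ₛ′; Inverse; Bijection; Equivalence)
open import Function.Properties.Inverse using (↔-refl; ↔-trans; ↔-sym; ↔⇒⤖)
open import Relation.Binary.PropositionalEquality
  using (_≡_; _≢_; refl; sym; trans; cong; cong₂; subst; module ≡-Reasoning)
open import Relation.Nullary using (¬_; does; yes; no; contradiction)
open import Relation.Nullary.Decidable using (dec-true; dec-false)

does-≟-sym : ∀ {k} (u v : Fin k) → does (u ≟ v) ≡ does (v ≟ u)
does-≟-sym u v with v ≟ u
... | yes v≡u = dec-true (u ≟ v) (sym v≡u)
... | no v≢u = dec-false (u ≟ v) (v≢u ∘ sym)

complement : SimpleGraph → SimpleGraph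
complement G = record
  { n = n G
  ; adj = λ u v → not (adj G u v) ∧ not (does (u ≟ v))
  ; sym = λ u v → cong₂ (λ a e → not a ∧ not e) (SimpleGraph.sym G u v) (does-≟-sym u v)
  ; loopless = λ u → trans (cong (λ e → not (adj G u u) ∧ not e) (dec-true (u ≟ u) refl))
                           (∧-zeroʳ _)
  }

complement-off-diagonal : (G : SimpleGraph) {u v : Fin (n G)} →
  u ≢ v → adj (complement G) u v ≡ not (adj G u v)
complement-off-diagonal G {u} {v} u≢v =
  trans (cong (λ e → not (adj G u v) ∧ not e) (dec-false (u ≟ v) u≢v)) (∧-identityʳ _)

complement-off-diagonal′ : (G : SimpleGraph) {u v : Fin (n G)} →
  u ≢ v → adj G u v ≡ not (adj (complement G) u v)
complement-off-diagonal′ G u≢v =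
  trans (sym (not-involutive _)) (cong not (sym (complement-off-diagonal G u≢v)))

complement-intro : (G : SimpleGraph) {u v : Fin (n G)} →
  u ≢ v → ¬ Adj G u v → Adj (complement G) u v
complement-intro G u≢v ¬uv = trans (complement-off-diagonal G u≢v) (cong not (¬-not ¬uv))

complement-elim : (G : SimpleGraph) {u v : Fin (n G)} →
  Adj (complement G) u v → u ≢ v × ¬ Adj G u v
complement-elim G {u} {v} uv with u ≟ v
-- the split on u ≟ v also evaluates the equality test inside uv
... | yes refl = contradiction (trans (sym (∧-zeroʳ _)) uv) λ ()
... | no u≢v = u≢v , λ adj≡true →
  contradiction (subst (λ b → not b ∧ true ≡ true) adj≡true uv) λ ()

walk-of-length-zero : ∀ {Λ u v} → Walk Λ 0 u v → u ≡ v
walk-of-length-zero here = refl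

walk-of-length-one : ∀ {Λ u v} → Walk Λ 1 u v → Adj Λ u v
walk-of-length-one (step uv here) = uv

distance-two⇒non-adjacent : ∀ {Λ u v} → Adj₂ Λ u v → u ≢ v × ¬ Adj Λ u v
distance-two⇒non-adjacent {Λ} {u} (_ , no-shorter) =
  (λ u≡v → no-shorter 0 (s≤s z≤n) (subst (Walk Λ 0 u) u≡v here))
  , (λ uv → no-shorter 1 (s≤s (s≤s z≤n)) (step uv here))

common-neighbour⇒distance-two : ∀ {Λ u w v} →
  u ≢ v → ¬ Adj Λ u v → Adj Λ u w → Adj Λ w v → Adj₂ Λ u v
common-neighbour⇒distance-two {Λ} {u} {w} {v} u≢v ¬uv uw wv = step uw (step wv here) , no-shorter
  where
  no-shorter : ∀ k → k < 2 → ¬ Walk Λ k u v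
  no-shorter 0 _ walk = u≢v (walk-of-length-zero walk)
  no-shorter 1 _ walk = ¬uv (walk-of-length-one walk)
  no-shorter (suc (suc _)) (s≤s (s≤s ()))

DiameterTwo : SimpleGraph → Set
DiameterTwo Λ = ∀ u v → u ≢ v → ¬ Adj Λ u v → ∃[ w ] Adj Λ u w × Adj Λ w v

distance-two⇔complement : ∀ {Λ} → DiameterTwo Λ → ∀ u v → Adj₂ Λ u v ⇔ Adj (complement Λ) u v
distance-two⇔complement {Λ} diameter u v = mk⇔ to-complement from-complement
  where
  to-complement : Adj₂ Λ u v → Adj (complement Λ) u v
  to-complement d with distance-two⇒non-adjacent d
  ... | u≢v , ¬uv = complement-intro Λ u≢v ¬uv

  from-complement : Adj (complement Λ) u v → Adj₂ Λ u v
  from-complement c with complement-elim Λ c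
  ... | u≢v , ¬uv with diameter u v u≢v ¬uv
  ...   | _ , uw , wv = common-neighbour⇒distance-two u≢v ¬uv uw wv

SelfComplementary : SimpleGraph → Set
SelfComplementary Λ = Σ (Fin (n Λ) ⤖ Fin (n Λ)) λ f →
  ∀ u v → adj Λ (Bijection.to f u) (Bijection.to f v) ≡ adj (complement Λ) u v

self-two-distance : ∀ {Λ} → DiameterTwo Λ → SelfComplementary Λ → SelfTwoDistance Λ
self-two-distance diameter (f , f-iso) = f , λ u v →
  let open Equivalence (distance-two⇔complement diameter u v) in
  mk⇔ (λ d → trans (f-iso u v) (to d)) (λ a → from (trans (sym (f-iso u v)) a))

-- A symmetric loopless Boolean relation on a type V, together with an
-- enumeration Fin N ↔ V, presents a simple graph; its properties can be
-- checked on V, where the vertices carry meaningful names.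
module Enumerated {V : Set} {N : ℕ} (enumeration : Fin N ↔ V) (edge : V → V → Bool)
  (edge-sym : ∀ a b → edge a b ≡ edge b a) (edge-loopless : ∀ a → edge a a ≡ false) where

  open Inverse enumeration using (to; from; strictlyInverseˡ; strictlyInverseʳ)

  graph : SimpleGraph
  graph = record
    { n = N
    ; adj = λ u v → edge (to u) (to v)
    ; sym = λ u v → edge-sym (to u) (to v)
    ; loopless = λ u → edge-loopless (to u)
    }

  to-injective : ∀ {u v} → to u ≡ to v → u ≡ v
  to-injective {u} {v} eq = trans (sym (strictlyInverseʳ u)) (trans (cong from eq) (strictlyInverseʳ v))

  from-injective : ∀ {a b} → from a ≡ from b → a ≡ b
  from-injective {a} {b} eq = trans (sym (strictlyInverseˡ a)) (trans (cong to eq) (strictlyInverseˡ b))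

  edge-from : ∀ a b → adj graph (from a) (from b) ≡ edge a b
  edge-from a b = cong₂ edge (strictlyInverseˡ a) (strictlyInverseˡ b)

  diameter-two : (∀ a b → a ≢ b → edge a b ≡ false → ∃[ c ] edge a c ≡ true × edge c b ≡ true) →
                 DiameterTwo graph
  diameter-two common u v u≢v ¬uv with common (to u) (to v) (u≢v ∘ to-injective) (¬-not ¬uv)
  ... | c , ac , cb = from c , trans (cong (edge (to u)) (strictlyInverseˡ c)) ac
                             , trans (cong (λ x → edge x (to v)) (strictlyInverseˡ c)) cb

  self-complementary : (ρ : V ↔ V) →
    (∀ a b → a ≢ b → edge (Inverse.to ρ a) (Inverse.to ρ b) ≡ not (edge a b)) →
    SelfComplementary graph
  self-complementary ρ ρ-negates = ↔⇒⤖ (↔-trans enumeration (↔-trans ρ (↔-sym enumeration))) , iso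
    where
    open ≡-Reasoning
    ρ′ = Inverse.to ρ
    iso : ∀ u v → edge (to (from (ρ′ (to u)))) (to (from (ρ′ (to v)))) ≡ adj (complement graph) u v
    iso u v with u ≟ v
    ... | yes refl = trans (edge-loopless _) (sym (∧-zeroʳ _))
    ... | no u≢v = begin
      edge (to (from (ρ′ (to u)))) (to (from (ρ′ (to v)))) ≡⟨ edge-from (ρ′ (to u)) (ρ′ (to v)) ⟩
      edge (ρ′ (to u)) (ρ′ (to v))                         ≡⟨ ρ-negates (to u) (to v) (u≢v ∘ to-injective) ⟩
      not (edge (to u) (to v))                             ≡⟨ sym (∧-identityʳ _) ⟩
      not (edge (to u) (to v)) ∧ true                      ∎

  induced-subgraph : (H : SimpleGraph) (ι : Fin (n H) → V) → (∀ {x y} → ι x ≡ ι y → x ≡ y) →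
                     (∀ x y → adj H x y ≡ edge (ι x) (ι y)) → InducedSubgraph H graph
  induced-subgraph H ι ι-injective ι-edge =
    from ∘ ι , ι-injective ∘ from-injective , λ x y → trans (ι-edge x y) (sym (edge-from (ι x) (ι y)))

-- The four non-central vertices of the pentagon, i.e. 1,2,3,4 in ℤ/5.
Part : Set
Part = Fin 4

pattern P1 = zero
pattern P2 = suc zero
pattern P3 = suc (suc zero)
pattern P4 = suc (suc (suc zero))

-- Multiplication by 2 in ℤ/5 (fixing 0), with its inverse.
double : Part → Part
double P1 = P2
double P2 = P4
double P3 = P1
double P4 = P3

halve : Part → Part
halve P1 = P3
halve P2 = P1
halve P3 = P4
halve P4 = P2

doubling : Part ↔ Part
doubling = mk↔ₛ′ double halve
  (λ { P1 → refl ; P2 → refl ; P3 → refl ; P4 → refl })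
  (λ { P1 → refl ; P2 → refl ; P3 → refl ; P4 → refl })

outer : Part → Bool
outer P1 = true
outer P2 = false
outer P3 = false
outer P4 = true

outer-double : ∀ p → outer (double p) ≡ not (outer p)
outer-double P1 = refl
outer-double P2 = refl
outer-double P3 = refl
outer-double P4 = refl

module PentagonBlowUp (G : SimpleGraph) where

  Vertex : Set
  Vertex = ⊤ ⊎ (Part × Fin (n G))

  pattern centre = inj₁ tt
  pattern ⟨_,_⟩ p x = inj₂ (p , x)

  link : Part → Part → Fin (n G) → Fin (n G) → Bool
  link P1 P1 x y = adj G x y
  link P2 P2 x y = adj (complement G) x y
  link P3 P3 x y = adj (complement G) x y
  link P4 P4 x y = adj G x y
  link P1 P2 _ _ = true
  link P2 P1 _ _ = true
  link P2 P3 _ _ = true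
  link P3 P2 _ _ = true
  link P3 P4 _ _ = true
  link P4 P3 _ _ = true
  link _ _ _ _ = false

  edge : Vertex → Vertex → Bool
  edge centre centre = false
  edge centre ⟨ p , _ ⟩ = outer p
  edge ⟨ p , _ ⟩ centre = outer p
  edge ⟨ p , x ⟩ ⟨ q , y ⟩ = link p q x y

  link-sym : ∀ p q x y → link p q x y ≡ link q p y x
  link-sym P1 P1 x y = SimpleGraph.sym G x y
  link-sym P1 P2 _ _ = refl
  link-sym P1 P3 _ _ = refl
  link-sym P1 P4 _ _ = refl
  link-sym P2 P1 _ _ = refl
  link-sym P2 P2 x y = SimpleGraph.sym (complement G) x y
  link-sym P2 P3 _ _ = refl
  link-sym P2 P4 _ _ = refl
  link-sym P3 P1 _ _ = refl
  link-sym P3 P2 _ _ = refl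
  link-sym P3 P3 x y = SimpleGraph.sym (complement G) x y
  link-sym P3 P4 _ _ = refl
  link-sym P4 P1 _ _ = refl
  link-sym P4 P2 _ _ = refl
  link-sym P4 P3 _ _ = refl
  link-sym P4 P4 x y = SimpleGraph.sym G x y

  edge-sym : ∀ a b → edge a b ≡ edge b a
  edge-sym centre centre = refl
  edge-sym centre ⟨ _ , _ ⟩ = refl
  edge-sym ⟨ _ , _ ⟩ centre = refl
  edge-sym ⟨ p , x ⟩ ⟨ q , y ⟩ = link-sym p q x y

  edge-loopless : ∀ a → edge a a ≡ false
  edge-loopless centre = refl
  edge-loopless ⟨ P1 , x ⟩ = loopless G x
  edge-loopless ⟨ P2 , x ⟩ = loopless (complement G) x
  edge-loopless ⟨ P3 , x ⟩ = loopless (complement G) x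
  edge-loopless ⟨ P4 , x ⟩ = loopless G x

  -- Doubling the parts negates adjacency between distinct vertices: the
  -- copies of G and of its complement are exchanged, as are the pentagon's
  -- edges and non-edges.
  link-double : ∀ p q x y → (p ≡ q → x ≢ y) → link (double p) (double q) x y ≡ not (link p q x y)
  link-double P1 P1 x y distinct = complement-off-diagonal G (distinct refl)
  link-double P2 P2 x y distinct = complement-off-diagonal′ G (distinct refl)
  link-double P3 P3 x y distinct = complement-off-diagonal′ G (distinct refl)
  link-double P4 P4 x y distinct = complement-off-diagonal G (distinct refl)
  link-double P1 P2 _ _ _ = refl
  link-double P1 P3 _ _ _ = refl
  link-double P1 P4 _ _ _ = refl
  link-double P2 P1 _ _ _ = refl
  link-double P2 P3 _ _ _ = refl
  link-double P2 P4 _ _ _ = refl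
  link-double P3 P1 _ _ _ = refl
  link-double P3 P2 _ _ _ = refl
  link-double P3 P4 _ _ _ = refl
  link-double P4 P1 _ _ _ = refl
  link-double P4 P2 _ _ _ = refl
  link-double P4 P3 _ _ _ = refl

  doubling-vertices : Vertex ↔ Vertex
  doubling-vertices = ↔-refl ⊎-↔ (doubling ×-↔ ↔-refl)

  doubling-negates : ∀ a b → a ≢ b →
    edge (Inverse.to doubling-vertices a) (Inverse.to doubling-vertices b) ≡ not (edge a b)
  doubling-negates centre centre a≢b = contradiction refl a≢b
  doubling-negates centre ⟨ p , _ ⟩ _ = outer-double p
  doubling-negates ⟨ p , _ ⟩ centre _ = outer-double p
  doubling-negates ⟨ p , x ⟩ ⟨ q , y ⟩ a≢b =
    link-double p q x y λ p≡q x≡y → a≢b (cong₂ ⟨_,_⟩ p≡q x≡y)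

  -- The blow-up has diameter at most two; each witness is read off the
  -- pentagon (the centre, or a vertex of a neighbouring blob).
  common-neighbour : ∀ a b → a ≢ b → edge a b ≡ false → ∃[ c ] edge a c ≡ true × edge c b ≡ true
  common-neighbour centre centre a≢b _ = contradiction refl a≢b
  common-neighbour centre ⟨ P1 , _ ⟩ _ ()
  common-neighbour centre ⟨ P2 , y ⟩ _ _ = ⟨ P1 , y ⟩ , refl , refl
  common-neighbour centre ⟨ P3 , y ⟩ _ _ = ⟨ P4 , y ⟩ , refl , refl
  common-neighbour centre ⟨ P4 , _ ⟩ _ ()
  common-neighbour ⟨ P1 , _ ⟩ centre _ ()
  common-neighbour ⟨ P2 , x ⟩ centre _ _ = ⟨ P1 , x ⟩ , refl , refl
  common-neighbour ⟨ P3 , x ⟩ centre _ _ = ⟨ P4 , x ⟩ , refl , refl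
  common-neighbour ⟨ P4 , _ ⟩ centre _ ()
  common-neighbour ⟨ P1 , _ ⟩ ⟨ P1 , _ ⟩ _ _ = centre , refl , refl
  common-neighbour ⟨ P1 , _ ⟩ ⟨ P2 , _ ⟩ _ ()
  common-neighbour ⟨ P1 , x ⟩ ⟨ P3 , _ ⟩ _ _ = ⟨ P2 , x ⟩ , refl , refl
  common-neighbour ⟨ P1 , _ ⟩ ⟨ P4 , _ ⟩ _ _ = centre , refl , refl
  common-neighbour ⟨ P2 , _ ⟩ ⟨ P1 , _ ⟩ _ ()
  common-neighbour ⟨ P2 , x ⟩ ⟨ P2 , _ ⟩ _ _ = ⟨ P1 , x ⟩ , refl , refl
  common-neighbour ⟨ P2 , _ ⟩ ⟨ P3 , _ ⟩ _ ()
  common-neighbour ⟨ P2 , x ⟩ ⟨ P4 , _ ⟩ _ _ = ⟨ P3 , x ⟩ , refl , refl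
  common-neighbour ⟨ P3 , x ⟩ ⟨ P1 , _ ⟩ _ _ = ⟨ P2 , x ⟩ , refl , refl
  common-neighbour ⟨ P3 , _ ⟩ ⟨ P2 , _ ⟩ _ ()
  common-neighbour ⟨ P3 , x ⟩ ⟨ P3 , _ ⟩ _ _ = ⟨ P4 , x ⟩ , refl , refl
  common-neighbour ⟨ P3 , _ ⟩ ⟨ P4 , _ ⟩ _ ()
  common-neighbour ⟨ P4 , _ ⟩ ⟨ P1 , _ ⟩ _ _ = centre , refl , refl
  common-neighbour ⟨ P4 , x ⟩ ⟨ P2 , _ ⟩ _ _ = ⟨ P3 , x ⟩ , refl , refl
  common-neighbour ⟨ P4 , _ ⟩ ⟨ P3 , _ ⟩ _ ()
  common-neighbour ⟨ P4 , _ ⟩ ⟨ P4 , _ ⟩ _ _ = centre , refl , refl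

  into-P1 : Fin (n G) → Vertex
  into-P1 x = ⟨ P1 , x ⟩

  into-P1-injective : ∀ {x y} → into-P1 x ≡ into-P1 y → x ≡ y
  into-P1-injective refl = refl

  enumeration : Fin (suc (4 * n G)) ↔ Vertex
  enumeration = ↔-trans +↔⊎ (1↔⊤ ⊎-↔ *↔×)

  open Enumerated enumeration edge edge-sym edge-loopless public

proposition2p3 : (G : SimpleGraph) → Σ SimpleGraph (λ Λ → SelfTwoDistance Λ × InducedSubgraph G Λ)
proposition2p3 G =
  graph
  , self-two-distance (diameter-two common-neighbour)
                      (self-complementary doubling-vertices doubling-negates)
  , induced-subgraph G into-P1 into-P1-injective (λ _ _ → refl)
  where open PentagonBlowUp G
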